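{- Let $T$ be a commutative monad on a category $\mathcal{A}$ with finite products, and assume $\mathrm{Alg}(T)$ is symmetric monoidal $(\otimes,I)$ with $I=T(1)$ such that the free functor $F\colon\mathcal{A}\to\mathrm{Alg}(T)$ is strong monoidal (from the cartesian structure) via natural monoidal isomorphisms $\xi\colon T(X)\otimes T(Y)\to T(X\times Y)$. Let $a\colon T(X)\to X$ be a $T$-algebra with a $\overline{T}$-coalgebra $b\colon X\to T(X)$ on it. Then the maps $d_b=(a\otimes a)\circ\xi^{ -1}\circ T(\Delta)\circ b\colon X\to X\otimes X$ and $u_b=T(!)\circ b\colon X\to T(1)=I$, where $\Delta\colon X\to X\times X$ is the diagonal and $!\colon X\to 1$, are maps of $T$-algebras forming a commutative comonoid $(X,d_b,u_b)$ in $\mathrm{Alg}(T)$.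
   Context: $\mathrm{Alg}(T)$ is the category of Eilenberg–Moore algebras of $T=(T,\eta,\mu)$; free algebras are $\mu_X\colon T^2X\to TX$, and an algebra $a\colon TX\to X$ is an algebra map $\mu_X\to a$, so $a\otimes a\colon T(X)\otimes T(X)\to X\otimes X$ makes sense in $\mathrm{Alg}(T)$. A $\overline{T}$-coalgebra (basis) on $a$ is a map $b\colon X\to TX$ in $\mathcal{A}$ with $b\circ a=\mu_X\circ T(b)$, $a\circ b=\mathrm{id}_X$ and $T(\eta_X)\circ b=T(b)\circ b$. -}

module Defs where

open import Level using (Level; _⊔_) renaming (suc to lsuc)
open import Relation.Binary.PropositionalEquality
  using (_≡_; refl; sym; trans; cong; cong₂; module ≡-Reasoning)
open import Data.Product using (Σ; _,_)

record Category (o ℓ : Level) : Set (lsuc (o ⊔ ℓ)) where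
  infixr 9 _∘_
  field
    Obj  : Set o
    Hom  : Obj → Obj → Set ℓ
    id   : ∀ {X} → Hom X X
    _∘_  : ∀ {X Y Z} → Hom Y Z → Hom X Y → Hom X Z
    identityˡ : ∀ {X Y} {f : Hom X Y} → id ∘ f ≡ f
    identityʳ : ∀ {X Y} {f : Hom X Y} → f ∘ id ≡ f
    assoc     : ∀ {W X Y Z} {f : Hom Y Z} {g : Hom X Y} {h : Hom W X} →
                (f ∘ g) ∘ h ≡ f ∘ (g ∘ h)

record FiniteProducts {o ℓ} (C : Category o ℓ) : Set (o ⊔ ℓ) where
  open Category C
  infixr 7 _×_
  field
    𝟙      : Obj
    !      : ∀ {X} → Hom X 𝟙
    !-uniq : ∀ {X} (f : Hom X 𝟙) → f ≡ !
    _×_    : Obj → Obj → Obj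
    π₁     : ∀ {X Y} → Hom (X × Y) X
    π₂     : ∀ {X Y} → Hom (X × Y) Y
    ⟨_,_⟩  : ∀ {Z X Y} → Hom Z X → Hom Z Y → Hom Z (X × Y)
    π₁-β   : ∀ {Z X Y} {f : Hom Z X} {g : Hom Z Y} → π₁ ∘ ⟨ f , g ⟩ ≡ f
    π₂-β   : ∀ {Z X Y} {f : Hom Z X} {g : Hom Z Y} → π₂ ∘ ⟨ f , g ⟩ ≡ g
    ⟨⟩-uniq : ∀ {Z X Y} {f : Hom Z X} {g : Hom Z Y} (h : Hom Z (X × Y)) →
              π₁ ∘ h ≡ f → π₂ ∘ h ≡ g → h ≡ ⟨ f , g ⟩

  infixr 8 _⊗×_
  _⊗×_ : ∀ {X Y X′ Y′} → Hom X X′ → Hom Y Y′ → Hom (X × Y) (X′ × Y′)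
  f ⊗× g = ⟨ f ∘ π₁ , g ∘ π₂ ⟩

  Δ : ∀ {X} → Hom X (X × X)
  Δ = ⟨ id , id ⟩

  swap : ∀ {X Y} → Hom (X × Y) (Y × X)
  swap = ⟨ π₂ , π₁ ⟩

  assoc× : ∀ {X Y Z} → Hom ((X × Y) × Z) (X × (Y × Z))
  assoc× = ⟨ π₁ ∘ π₁ , ⟨ π₂ ∘ π₁ , π₂ ⟩ ⟩

record Monad {o ℓ} (C : Category o ℓ) : Set (o ⊔ ℓ) where
  open Category C
  field
    T₀ : Obj → Obj
    T₁ : ∀ {X Y} → Hom X Y → Hom (T₀ X) (T₀ Y)
    T-id : ∀ {X} → T₁ (id {X}) ≡ id
    T-∘  : ∀ {X Y Z} {f : Hom Y Z} {g : Hom X Y} → T₁ (f ∘ g) ≡ T₁ f ∘ T₁ g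
    η  : ∀ X → Hom X (T₀ X)
    μ  : ∀ X → Hom (T₀ (T₀ X)) (T₀ X)
    η-natural : ∀ {X Y} {f : Hom X Y} → η Y ∘ f ≡ T₁ f ∘ η X
    μ-natural : ∀ {X Y} {f : Hom X Y} → μ Y ∘ T₁ (T₁ f) ≡ T₁ f ∘ μ X
    μ-assoc   : ∀ {X} → μ X ∘ T₁ (μ X) ≡ μ X ∘ μ (T₀ X)
    μ-unitˡ   : ∀ {X} → μ X ∘ η (T₀ X) ≡ id
    μ-unitʳ   : ∀ {X} → μ X ∘ T₁ (η X) ≡ id

record Strength {o ℓ} (C : Category o ℓ) (P : FiniteProducts C) (M : Monad C)
       : Set (o ⊔ ℓ) where
  open Category C
  open FiniteProducts P
  open Monad M
  field
    st : ∀ X Y → Hom (X × T₀ Y) (T₀ (X × Y))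
    st-natural : ∀ {X X′ Y Y′} {f : Hom X X′} {g : Hom Y Y′} →
                 st X′ Y′ ∘ (f ⊗× T₁ g) ≡ T₁ (f ⊗× g) ∘ st X Y
    st-unit    : ∀ {Y} → T₁ π₂ ∘ st 𝟙 Y ≡ π₂
    st-assoc   : ∀ {X Y Z} →
                 T₁ assoc× ∘ st (X × Y) Z ≡ st X (Y × Z) ∘ (id ⊗× st Y Z) ∘ assoc×
    st-η       : ∀ {X Y} → st X Y ∘ (id ⊗× η Y) ≡ η (X × Y)
    st-μ       : ∀ {X Y} →
                 st X Y ∘ (id ⊗× μ Y) ≡ μ (X × Y) ∘ T₁ (st X Y) ∘ st X (T₀ Y)

  st′ : ∀ X Y → Hom (T₀ X × Y) (T₀ (X × Y))
  st′ X Y = T₁ swap ∘ st Y X ∘ swap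

  dst₁ : ∀ X Y → Hom (T₀ X × T₀ Y) (T₀ (X × Y))
  dst₁ X Y = μ (X × Y) ∘ T₁ (st′ X Y) ∘ st (T₀ X) Y

  dst₂ : ∀ X Y → Hom (T₀ X × T₀ Y) (T₀ (X × Y))
  dst₂ X Y = μ (X × Y) ∘ T₁ (st X Y) ∘ st′ X (T₀ Y)

record CommutativeMonad {o ℓ} (C : Category o ℓ) (P : FiniteProducts C)
       : Set (o ⊔ ℓ) where
  field
    monad    : Monad C
    strength : Strength C P monad
  open Strength strength
  field
    commutative : ∀ X Y → dst₁ X Y ≡ dst₂ X Y

module Alg {o ℓ} (C : Category o ℓ) (M : Monad C) where
  open Category C
  open Monad M

  record Algebra : Set (o ⊔ ℓ) where
    constructor mkAlg
    field
      Carrier : Obj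
      str     : Hom (T₀ Carrier) Carrier
      str-η   : str ∘ η Carrier ≡ id
      str-μ   : str ∘ T₁ str ≡ str ∘ μ Carrier
  open Algebra public

  IsAlgHom : (A B : Algebra) → Hom (Carrier A) (Carrier B) → Set ℓ
  IsAlgHom A B f = f ∘ str A ≡ str B ∘ T₁ f

  record AlgHom (A B : Algebra) : Set ℓ where
    constructor mkHom
    field
      map  : Hom (Carrier A) (Carrier B)
      comm : IsAlgHom A B map
  open AlgHom public

  _≈H_ : ∀ {A B} → AlgHom A B → AlgHom A B → Set ℓ
  f ≈H g = map f ≡ map g

  idH : ∀ {A} → AlgHom A A
  idH {A} = mkHom id (trans identityˡ (sym (trans (cong (str A ∘_) T-id) identityʳ)))

  infixr 9 _∘H_
  _∘H_ : ∀ {A B D} → AlgHom B D → AlgHom A B → AlgHom A D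
  _∘H_ {A} {B} {D} f g = mkHom (map f ∘ map g) pf
    where
    open ≡-Reasoning
    pf : (map f ∘ map g) ∘ str A ≡ str D ∘ T₁ (map f ∘ map g)
    pf = begin
      (map f ∘ map g) ∘ str A   ≡⟨ assoc ⟩
      map f ∘ (map g ∘ str A)   ≡⟨ cong (map f ∘_) (comm g) ⟩
      map f ∘ (str B ∘ T₁ (map g)) ≡⟨ sym assoc ⟩
      (map f ∘ str B) ∘ T₁ (map g) ≡⟨ cong (_∘ T₁ (map g)) (comm f) ⟩
      (str D ∘ T₁ (map f)) ∘ T₁ (map g) ≡⟨ assoc ⟩
      str D ∘ (T₁ (map f) ∘ T₁ (map g)) ≡⟨ cong (str D ∘_) (sym T-∘) ⟩
      str D ∘ T₁ (map f ∘ map g) ∎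

  Free : Obj → Algebra
  Free X = mkAlg (T₀ X) (μ X) μ-unitˡ μ-assoc

  Free₁ : ∀ {X Y} → Hom X Y → AlgHom (Free X) (Free Y)
  Free₁ f = mkHom (T₁ f) (sym μ-natural)

  asHom : (A : Algebra) → AlgHom (Free (Carrier A)) A
  asHom A = mkHom (str A) (sym (str-μ A))

  -- a T̄-coalgebra (basis) on an algebra
  record Basis (A : Algebra) : Set ℓ where
    field
      b      : Hom (Carrier A) (T₀ (Carrier A))
      b-str  : b ∘ str A ≡ μ (Carrier A) ∘ T₁ b
      str-b  : str A ∘ b ≡ id
      b-coassoc : T₁ (η (Carrier A)) ∘ b ≡ T₁ b ∘ b

record SymMonoidalAlg {o ℓ} (C : Category o ℓ) (P : FiniteProducts C)
       (M : Monad C) : Set (o ⊔ ℓ) where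
  open Category C
  open FiniteProducts P using (𝟙)
  open Alg C M
  infixr 10 _⊗₀_ _⊗₁_

  I : Algebra
  I = Free 𝟙

  field
    _⊗₀_ : Algebra → Algebra → Algebra
    _⊗₁_ : ∀ {A B A′ B′} → AlgHom A A′ → AlgHom B B′ → AlgHom (A ⊗₀ B) (A′ ⊗₀ B′)
    ⊗-id : ∀ {A B} → (idH {A} ⊗₁ idH {B}) ≈H idH
    ⊗-∘  : ∀ {A B C′ A₁ B₁ C₁}
             {f : AlgHom B C′} {g : AlgHom A B} {h : AlgHom B₁ C₁} {k : AlgHom A₁ B₁} →
             ((f ∘H g) ⊗₁ (h ∘H k)) ≈H ((f ⊗₁ h) ∘H (g ⊗₁ k))

    λ⇒ : ∀ {A} → AlgHom (I ⊗₀ A) A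
    λ⇐ : ∀ {A} → AlgHom A (I ⊗₀ A)
    ρ⇒ : ∀ {A} → AlgHom (A ⊗₀ I) A
    ρ⇐ : ∀ {A} → AlgHom A (A ⊗₀ I)
    α⇒ : ∀ {A B D} → AlgHom ((A ⊗₀ B) ⊗₀ D) (A ⊗₀ (B ⊗₀ D))
    α⇐ : ∀ {A B D} → AlgHom (A ⊗₀ (B ⊗₀ D)) ((A ⊗₀ B) ⊗₀ D)
    σ  : ∀ {A B} → AlgHom (A ⊗₀ B) (B ⊗₀ A)

    λ-iso₁ : ∀ {A} → (λ⇒ {A} ∘H λ⇐) ≈H idH
    λ-iso₂ : ∀ {A} → (λ⇐ {A} ∘H λ⇒) ≈H idH
    ρ-iso₁ : ∀ {A} → (ρ⇒ {A} ∘H ρ⇐) ≈H idH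
    ρ-iso₂ : ∀ {A} → (ρ⇐ {A} ∘H ρ⇒) ≈H idH
    α-iso₁ : ∀ {A B D} → (α⇒ {A} {B} {D} ∘H α⇐) ≈H idH
    α-iso₂ : ∀ {A B D} → (α⇐ {A} {B} {D} ∘H α⇒) ≈H idH
    σ-invol : ∀ {A B} → (σ {B} {A} ∘H σ {A} {B}) ≈H idH

    λ-natural : ∀ {A B} {f : AlgHom A B} → (f ∘H λ⇒) ≈H (λ⇒ ∘H (idH ⊗₁ f))
    ρ-natural : ∀ {A B} {f : AlgHom A B} → (f ∘H ρ⇒) ≈H (ρ⇒ ∘H (f ⊗₁ idH))
    α-natural : ∀ {A B D A′ B′ D′}
                  {f : AlgHom A A′} {g : AlgHom B B′} {h : AlgHom D D′} →
                  ((f ⊗₁ (g ⊗₁ h)) ∘H α⇒) ≈H (α⇒ ∘H ((f ⊗₁ g) ⊗₁ h))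
    σ-natural : ∀ {A B A′ B′} {f : AlgHom A A′} {g : AlgHom B B′} →
                  ((g ⊗₁ f) ∘H σ) ≈H (σ ∘H (f ⊗₁ g))

    triangle : ∀ {A B} →
      ((idH {A} ⊗₁ λ⇒ {B}) ∘H α⇒) ≈H (ρ⇒ ⊗₁ idH)
    pentagon : ∀ {A B D E} →
      ((idH {A} ⊗₁ α⇒ {B} {D} {E}) ∘H α⇒ ∘H (α⇒ ⊗₁ idH))
        ≈H (α⇒ ∘H α⇒)
    hexagon : ∀ {A B D} →
      (α⇒ {B} {D} {A} ∘H σ {A} {B ⊗₀ D} ∘H α⇒)
        ≈H ((idH ⊗₁ σ) ∘H α⇒ ∘H (σ ⊗₁ idH))

-- The free functor F is (symmetric) strong monoidal from the cartesian
-- structure, via natural isomorphisms ξ : F X ⊗ F Y → F (X × Y); the unit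
-- comparison is the identity I = F 1.

record StrongMonoidalFree {o ℓ} (C : Category o ℓ) (P : FiniteProducts C)
       (M : Monad C) (S : SymMonoidalAlg C P M) : Set (o ⊔ ℓ) where
  open Category C
  open FiniteProducts P
  open Alg C M
  open SymMonoidalAlg S
  field
    ξ  : ∀ X Y → AlgHom (Free X ⊗₀ Free Y) (Free (X × Y))
    ξ⁻¹ : ∀ X Y → AlgHom (Free (X × Y)) (Free X ⊗₀ Free Y)
    ξ-iso₁ : ∀ {X Y} → (ξ X Y ∘H ξ⁻¹ X Y) ≈H idH
    ξ-iso₂ : ∀ {X Y} → (ξ⁻¹ X Y ∘H ξ X Y) ≈H idH
    ξ-natural : ∀ {X Y X′ Y′} {f : Hom X X′} {g : Hom Y Y′} →
                (ξ X′ Y′ ∘H (Free₁ f ⊗₁ Free₁ g)) ≈H (Free₁ (f ⊗× g) ∘H ξ X Y)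
    ξ-assoc : ∀ {X Y Z} →
      (Free₁ assoc× ∘H ξ (X × Y) Z ∘H (ξ X Y ⊗₁ idH))
        ≈H (ξ X (Y × Z) ∘H (idH ⊗₁ ξ Y Z) ∘H α⇒)
    ξ-unitˡ : ∀ {X} → λ⇒ {Free X} ≈H (Free₁ π₂ ∘H ξ 𝟙 X)
    ξ-unitʳ : ∀ {X} → ρ⇒ {Free X} ≈H (Free₁ π₁ ∘H ξ X 𝟙)
    ξ-symmetric : ∀ {X Y} → (Free₁ swap ∘H ξ X Y) ≈H (ξ Y X ∘H σ)

module Comonoid {o ℓ} (C : Category o ℓ) (P : FiniteProducts C) (M : Monad C)
       (S : SymMonoidalAlg C P M) (Fm : StrongMonoidalFree C P M S) where
  open Category C
  open FiniteProducts P
  open Monad M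
  open Alg C M
  open SymMonoidalAlg S
  open StrongMonoidalFree Fm

  d-map : (A : Algebra) → Basis A → Hom (Carrier A) (Carrier (A ⊗₀ A))
  d-map A β = map (asHom A ⊗₁ asHom A) ∘ map (ξ⁻¹ (Carrier A) (Carrier A))
              ∘ T₁ Δ ∘ Basis.b β

  u-map : (A : Algebra) → Basis A → Hom (Carrier A) (Carrier I)
  u-map A β = T₁ ! ∘ Basis.b β

  record IsCommComonoid (A : Algebra) (d : AlgHom A (A ⊗₀ A)) (u : AlgHom A I)
         : Set ℓ where
    field
      counitˡ : (λ⇒ ∘H (u ⊗₁ idH) ∘H d) ≈H idH
      counitʳ : (ρ⇒ ∘H (idH ⊗₁ u) ∘H d) ≈H idH
      coassoc : (α⇒ ∘H (d ⊗₁ idH) ∘H d) ≈H ((idH ⊗₁ d) ∘H d)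
      cocomm  : (σ ∘H d) ≈H d

  Conclusion : (A : Algebra) → Basis A → Set ℓ
  Conclusion A β =
    Σ (IsAlgHom A (A ⊗₀ A) (d-map A β)) λ dh →
    Σ (IsAlgHom A I (u-map A β)) λ uh →
    IsCommComonoid A (mkHom (d-map A β) dh) (mkHom (u-map A β) uh)

module Submission where

-- Being strong monoidal, the free functor carries the diagonal comonoid
-- (Δ, !) of X in 𝒜 to a commutative comonoid (ξ⁻¹ ∘ T Δ, T !) on the free
-- algebra T X.  The algebra A is a retract of T X in Alg(T), since a ∘ b = id,
-- and the coassociativity T(η) ∘ b = T(b) ∘ b of the basis makes the section
-- b compatible with comultiplication: (b ⊗ b) ∘ d_b = δ ∘ b.  A commutative
-- comonoid structure restricts along any such retract, and the restriction is
-- exactly (d_b, u_b).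

open import Level using (Level)
open import Data.Product using (_,_)
open import Relation.Binary.PropositionalEquality
  using (_≡_; refl; sym; trans; cong; cong₂; subst; module ≡-Reasoning)
open import Axiom.UniquenessOfIdentityProofs.WithK using (uip)
open import Defs

module CategoryLemmas {o ℓ} (C : Category o ℓ) where
  open Category C
  open ≡-Reasoning

  ∘-congˡ : ∀ {X Y Z} {f : Hom Y Z} {g g′ : Hom X Y} → g ≡ g′ → f ∘ g ≡ f ∘ g′
  ∘-congˡ {f = f} = cong (f ∘_)

  ∘-congʳ : ∀ {X Y Z} {f f′ : Hom Y Z} {g : Hom X Y} → f ≡ f′ → f ∘ g ≡ f′ ∘ g
  ∘-congʳ {g = g} = cong (_∘ g)

  pullˡ : ∀ {W X Y Z} {f : Hom Y Z} {g : Hom X Y} {h : Hom X Z} {k : Hom W X} →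
          f ∘ g ≡ h → f ∘ (g ∘ k) ≡ h ∘ k
  pullˡ e = trans (sym assoc) (∘-congʳ e)

  cancelˡ : ∀ {W X Y} {f : Hom Y X} {g : Hom X Y} {k : Hom W X} →
            f ∘ g ≡ id → f ∘ (g ∘ k) ≡ k
  cancelˡ e = trans (pullˡ e) identityˡ

  cancelʳ : ∀ {W X Y} {f : Hom X Y} {g : Hom W X} {h : Hom X W} →
            g ∘ h ≡ id → (f ∘ g) ∘ h ≡ f
  cancelʳ e = trans assoc (trans (∘-congˡ e) identityʳ)

  assoc³ : ∀ {V W X Y Z} {f : Hom Y Z} {g : Hom X Y} {h : Hom W X} {k : Hom V W} →
           (f ∘ (g ∘ h)) ∘ k ≡ f ∘ (g ∘ (h ∘ k))
  assoc³ = trans assoc (∘-congˡ assoc)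

  inverse-∘ : ∀ {X Y Z} {m : Hom Z Y} {n : Hom Y Z} {p : Hom X Y} {q : Hom Y X} →
              m ∘ n ≡ id → q ∘ p ≡ id → (q ∘ m) ∘ (n ∘ p) ≡ id
  inverse-∘ mn qp = trans assoc (trans (∘-congˡ (cancelˡ mn)) qp)

  commute-inverses : ∀ {X Y X′ Y′} {f : Hom X X′} {g : Hom Y Y′}
                     {i : Hom X Y} {j : Hom Y X} {i′ : Hom X′ Y′} {j′ : Hom Y′ X′} →
                     j′ ∘ i′ ≡ id → i ∘ j ≡ id → i′ ∘ f ≡ g ∘ i → f ∘ j ≡ j′ ∘ g
  commute-inverses {f = f} {g} {i} {j} {i′} {j′} ji ij square = begin
    f ∘ j                 ≡⟨ sym (cancelˡ ji) ⟩
    j′ ∘ (i′ ∘ (f ∘ j))   ≡⟨ ∘-congˡ (pullˡ square) ⟩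
    j′ ∘ ((g ∘ i) ∘ j)    ≡⟨ ∘-congˡ (trans assoc (∘-congˡ ij)) ⟩
    j′ ∘ (g ∘ id)         ≡⟨ ∘-congˡ identityʳ ⟩
    j′ ∘ g                ∎

module ProductLemmas {o ℓ} (C : Category o ℓ) (P : FiniteProducts C) where
  open Category C
  open FiniteProducts P
  open CategoryLemmas C
  open ≡-Reasoning

  ⟨⟩∘ : ∀ {W Z X Y} {f : Hom Z X} {g : Hom Z Y} {h : Hom W Z} →
        ⟨ f , g ⟩ ∘ h ≡ ⟨ f ∘ h , g ∘ h ⟩
  ⟨⟩∘ = ⟨⟩-uniq _ (pullˡ π₁-β) (pullˡ π₂-β)

  ⊗×∘⟨⟩ : ∀ {W X Y X′ Y′} {f : Hom X X′} {g : Hom Y Y′} {h : Hom W X} {k : Hom W Y} →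
          (f ⊗× g) ∘ ⟨ h , k ⟩ ≡ ⟨ f ∘ h , g ∘ k ⟩
  ⊗×∘⟨⟩ = trans ⟨⟩∘ (cong₂ ⟨_,_⟩ (trans assoc (∘-congˡ π₁-β))
                                 (trans assoc (∘-congˡ π₂-β)))

  ⊗×∘Δ : ∀ {X X′ Y′} {f : Hom X X′} {g : Hom X Y′} → (f ⊗× g) ∘ Δ ≡ ⟨ f , g ⟩
  ⊗×∘Δ = trans ⊗×∘⟨⟩ (cong₂ ⟨_,_⟩ identityʳ identityʳ)

  Δ-natural : ∀ {X Y} {f : Hom X Y} → (f ⊗× f) ∘ Δ ≡ Δ ∘ f
  Δ-natural = trans ⊗×∘Δ (sym (trans ⟨⟩∘ (cong₂ ⟨_,_⟩ identityˡ identityˡ)))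

  swap∘Δ : ∀ {X} → swap ∘ Δ {X} ≡ Δ
  swap∘Δ = trans ⟨⟩∘ (cong₂ ⟨_,_⟩ π₂-β π₁-β)

  assoc×∘Δ⊗×id∘Δ : ∀ {X} → assoc× ∘ ((Δ ⊗× id) ∘ Δ {X}) ≡ (id ⊗× Δ) ∘ Δ
  assoc×∘Δ⊗×id∘Δ = begin
    assoc× ∘ ((Δ ⊗× id) ∘ Δ)   ≡⟨ ∘-congˡ ⊗×∘Δ ⟩
    assoc× ∘ ⟨ Δ , id ⟩         ≡⟨ ⟨⟩∘ ⟩
    ⟨ (π₁ ∘ π₁) ∘ ⟨ Δ , id ⟩ , ⟨ π₂ ∘ π₁ , π₂ ⟩ ∘ ⟨ Δ , id ⟩ ⟩
      ≡⟨ cong₂ ⟨_,_⟩ (trans assoc (trans (∘-congˡ π₁-β) π₁-β))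
                     (trans ⟨⟩∘ (cong₂ ⟨_,_⟩ (trans assoc (trans (∘-congˡ π₁-β) π₂-β))
                                             π₂-β)) ⟩
    ⟨ id , Δ ⟩                  ≡⟨ sym ⊗×∘Δ ⟩
    (id ⊗× Δ) ∘ Δ               ∎

module MonoidalAlgLemmas {o ℓ} (C : Category o ℓ) (P : FiniteProducts C)
       (M : Monad C) (S : SymMonoidalAlg C P M) where
  open Category C
  open Alg C M
  open SymMonoidalAlg S

  AlgHom-≡ : ∀ {A B} {f g : AlgHom A B} → map f ≡ map g → f ≡ g
  AlgHom-≡ {f = mkHom m p} {mkHom .m q} refl = cong (mkHom m) (uip p q)

  -- _⊗₁_ is only assumed to act on algebra maps, so respecting ≈H needs
  -- proof irrelevance of IsAlgHom.
  ⊗₁-cong : ∀ {A B A′ B′} {f f′ : AlgHom A A′} {g g′ : AlgHom B B′} →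
            map f ≡ map f′ → map g ≡ map g′ → map (f ⊗₁ g) ≡ map (f′ ⊗₁ g′)
  ⊗₁-cong f≈f′ g≈g′ = cong map (cong₂ _⊗₁_ (AlgHom-≡ f≈f′) (AlgHom-≡ g≈g′))

  ⊗₁-factor : ∀ {A₀ A₁ A₂ B₀ B₁ B₂}
              {f : AlgHom A₀ A₂} {f₁ : AlgHom A₁ A₂} {f₂ : AlgHom A₀ A₁}
              {g : AlgHom B₀ B₂} {g₁ : AlgHom B₁ B₂} {g₂ : AlgHom B₀ B₁} →
              map f ≡ map f₁ ∘ map f₂ → map g ≡ map g₁ ∘ map g₂ →
              map (f ⊗₁ g) ≡ map (f₁ ⊗₁ g₁) ∘ map (f₂ ⊗₁ g₂)
  ⊗₁-factor {f₁ = f₁} {f₂} {g₁ = g₁} {g₂} f≈ g≈ =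
    trans (⊗₁-cong {f′ = f₁ ∘H f₂} {g′ = g₁ ∘H g₂} f≈ g≈) ⊗-∘

  ⊗₁-identity : ∀ {A B} {f : AlgHom A A} {g : AlgHom B B} →
                map f ≡ id → map g ≡ id → map (f ⊗₁ g) ≡ id
  ⊗₁-identity f≈id g≈id = trans (⊗₁-cong {f′ = idH} {g′ = idH} f≈id g≈id) ⊗-id

module FreeComonoids {o ℓ} (C : Category o ℓ) (P : FiniteProducts C)
       (M : Monad C) (S : SymMonoidalAlg C P M) (Fm : StrongMonoidalFree C P M S) where
  open Category C
  open FiniteProducts P
  open Monad M
  open Alg C M
  open SymMonoidalAlg S
  open StrongMonoidalFree Fm
  open Comonoid C P M S Fm
  open CategoryLemmas C
  open ProductLemmas C P
  open MonoidalAlgLemmas C P M S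
  open ≡-Reasoning

  T₁-square : ∀ {W X Y Z} {f : Hom W X} {g : Hom X Z} {h : Hom W Y} {k : Hom Y Z} →
              g ∘ f ≡ k ∘ h → T₁ g ∘ T₁ f ≡ T₁ k ∘ T₁ h
  T₁-square e = trans (sym T-∘) (trans (cong T₁ e) T-∘)

  id≡id∘T₁id : ∀ {X} → id {T₀ X} ≡ id ∘ T₁ id
  id≡id∘T₁id = sym (trans identityˡ T-id)

  ξ⁻¹-natural : ∀ {X Y X′ Y′} {f : Hom X X′} {g : Hom Y Y′} →
                map (Free₁ f ⊗₁ Free₁ g) ∘ map (ξ⁻¹ X Y) ≡ map (ξ⁻¹ X′ Y′) ∘ T₁ (f ⊗× g)
  ξ⁻¹-natural = commute-inverses ξ-iso₂ ξ-iso₁ ξ-natural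

  ξ⁻¹-symmetric : ∀ {X Y} →
                  map (σ {Free X} {Free Y}) ∘ map (ξ⁻¹ X Y) ≡ map (ξ⁻¹ Y X) ∘ T₁ swap
  ξ⁻¹-symmetric = commute-inverses ξ-iso₂ ξ-iso₁ (sym ξ-symmetric)

  ξ⁻¹-unitˡ : ∀ {X} → map (λ⇒ {Free X}) ∘ map (ξ⁻¹ 𝟙 X) ≡ T₁ π₂
  ξ⁻¹-unitˡ = trans (∘-congʳ ξ-unitˡ) (cancelʳ ξ-iso₁)

  ξ⁻¹-unitʳ : ∀ {X} → map (ρ⇒ {Free X}) ∘ map (ξ⁻¹ X 𝟙) ≡ T₁ π₁
  ξ⁻¹-unitʳ = trans (∘-congʳ ξ-unitʳ) (cancelʳ ξ-iso₁)

  ξ⁻¹-assoc : ∀ {X Y Z} →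
    map (α⇒ {Free X} {Free Y} {Free Z}) ∘ (map (ξ⁻¹ X Y ⊗₁ idH) ∘ map (ξ⁻¹ (X × Y) Z))
      ≡ (map (idH ⊗₁ ξ⁻¹ Y Z) ∘ map (ξ⁻¹ X (Y × Z))) ∘ T₁ assoc×
  ξ⁻¹-assoc = commute-inverses
    (inverse-∘ ξ-iso₂ (trans (sym ⊗-∘) (⊗₁-identity identityˡ ξ-iso₂)))
    (inverse-∘ (trans (sym ⊗-∘) (⊗₁-identity ξ-iso₁ identityˡ)) ξ-iso₁)
    (trans assoc (sym ξ-assoc))

  δ : ∀ X → AlgHom (Free X) (Free X ⊗₀ Free X)
  δ X = ξ⁻¹ X X ∘H Free₁ Δ

  ε : ∀ X → AlgHom (Free X) I
  ε X = Free₁ !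

  δ-natural : ∀ {X Y} {f : Hom X Y} →
              map (Free₁ f ⊗₁ Free₁ f) ∘ map (δ X) ≡ map (δ Y) ∘ T₁ f
  δ-natural {X} {Y} {f} = begin
    map (Free₁ f ⊗₁ Free₁ f) ∘ (map (ξ⁻¹ X X) ∘ T₁ Δ)  ≡⟨ pullˡ ξ⁻¹-natural ⟩
    (map (ξ⁻¹ Y Y) ∘ T₁ (f ⊗× f)) ∘ T₁ Δ               ≡⟨ assoc ⟩
    map (ξ⁻¹ Y Y) ∘ (T₁ (f ⊗× f) ∘ T₁ Δ)               ≡⟨ ∘-congˡ (T₁-square Δ-natural) ⟩
    map (ξ⁻¹ Y Y) ∘ (T₁ Δ ∘ T₁ f)                      ≡⟨ sym assoc ⟩
    (map (ξ⁻¹ Y Y) ∘ T₁ Δ) ∘ T₁ f                      ∎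

  free-isCommComonoid : ∀ X → IsCommComonoid (Free X) (δ X) (ε X)
  free-isCommComonoid X = record
    { counitˡ = counitˡ ; counitʳ = counitʳ ; coassoc = coassoc ; cocomm = cocomm }
    where
    Ξ = map (ξ⁻¹ X X)

    counitˡ : map λ⇒ ∘ (map (ε X ⊗₁ idH) ∘ (Ξ ∘ T₁ Δ)) ≡ id
    counitˡ = begin
      map λ⇒ ∘ (map (Free₁ ! ⊗₁ idH) ∘ (Ξ ∘ T₁ Δ))
        ≡⟨ ∘-congˡ (∘-congʳ (⊗₁-cong {g′ = Free₁ id} refl (sym T-id))) ⟩
      map λ⇒ ∘ (map (Free₁ ! ⊗₁ Free₁ id) ∘ (Ξ ∘ T₁ Δ))
        ≡⟨ ∘-congˡ (trans (pullˡ ξ⁻¹-natural) assoc) ⟩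
      map λ⇒ ∘ (map (ξ⁻¹ 𝟙 X) ∘ (T₁ (! ⊗× id) ∘ T₁ Δ))
        ≡⟨ pullˡ ξ⁻¹-unitˡ ⟩
      T₁ π₂ ∘ (T₁ (! ⊗× id) ∘ T₁ Δ)
        ≡⟨ ∘-congˡ (sym T-∘) ⟩
      T₁ π₂ ∘ T₁ ((! ⊗× id) ∘ Δ)
        ≡⟨ trans (sym T-∘) (cong T₁ (trans (∘-congˡ ⊗×∘Δ) π₂-β)) ⟩
      T₁ id
        ≡⟨ T-id ⟩
      id ∎

    counitʳ : map ρ⇒ ∘ (map (idH ⊗₁ ε X) ∘ (Ξ ∘ T₁ Δ)) ≡ id
    counitʳ = begin
      map ρ⇒ ∘ (map (idH ⊗₁ Free₁ !) ∘ (Ξ ∘ T₁ Δ))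
        ≡⟨ ∘-congˡ (∘-congʳ (⊗₁-cong {f′ = Free₁ id} (sym T-id) refl)) ⟩
      map ρ⇒ ∘ (map (Free₁ id ⊗₁ Free₁ !) ∘ (Ξ ∘ T₁ Δ))
        ≡⟨ ∘-congˡ (trans (pullˡ ξ⁻¹-natural) assoc) ⟩
      map ρ⇒ ∘ (map (ξ⁻¹ X 𝟙) ∘ (T₁ (id ⊗× !) ∘ T₁ Δ))
        ≡⟨ pullˡ ξ⁻¹-unitʳ ⟩
      T₁ π₁ ∘ (T₁ (id ⊗× !) ∘ T₁ Δ)
        ≡⟨ ∘-congˡ (sym T-∘) ⟩
      T₁ π₁ ∘ T₁ ((id ⊗× !) ∘ Δ)
        ≡⟨ trans (sym T-∘) (cong T₁ (trans (∘-congˡ ⊗×∘Δ) π₁-β)) ⟩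
      T₁ id
        ≡⟨ T-id ⟩
      id ∎

    coassoc : map α⇒ ∘ (map (δ X ⊗₁ idH) ∘ (Ξ ∘ T₁ Δ)) ≡ map (idH ⊗₁ δ X) ∘ (Ξ ∘ T₁ Δ)
    coassoc = begin
      map α⇒ ∘ (map (δ X ⊗₁ idH) ∘ (Ξ ∘ T₁ Δ))
        ≡⟨ ∘-congˡ (∘-congʳ (⊗₁-factor refl id≡id∘T₁id)) ⟩
      map α⇒ ∘ ((map (ξ⁻¹ X X ⊗₁ idH) ∘ map (Free₁ Δ ⊗₁ Free₁ id)) ∘ (Ξ ∘ T₁ Δ))
        ≡⟨ ∘-congˡ (trans assoc (∘-congˡ (trans (pullˡ ξ⁻¹-natural) assoc))) ⟩
      map α⇒ ∘ (map (ξ⁻¹ X X ⊗₁ idH) ∘ (map (ξ⁻¹ (X × X) X) ∘ (T₁ (Δ ⊗× id) ∘ T₁ Δ)))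
        ≡⟨ sym assoc³ ⟩
      (map α⇒ ∘ (map (ξ⁻¹ X X ⊗₁ idH) ∘ map (ξ⁻¹ (X × X) X))) ∘ (T₁ (Δ ⊗× id) ∘ T₁ Δ)
        ≡⟨ ∘-congʳ ξ⁻¹-assoc ⟩
      ((map (idH ⊗₁ ξ⁻¹ X X) ∘ map (ξ⁻¹ X (X × X))) ∘ T₁ assoc×) ∘ (T₁ (Δ ⊗× id) ∘ T₁ Δ)
        ≡⟨ trans assoc (∘-congˡ (trans (∘-congˡ (sym T-∘)) (T₁-square assoc×∘Δ⊗×id∘Δ))) ⟩
      (map (idH ⊗₁ ξ⁻¹ X X) ∘ map (ξ⁻¹ X (X × X))) ∘ (T₁ (id ⊗× Δ) ∘ T₁ Δ)
        ≡⟨ trans assoc (∘-congˡ (trans (pullˡ (sym ξ⁻¹-natural)) assoc)) ⟩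
      map (idH ⊗₁ ξ⁻¹ X X) ∘ (map (Free₁ id ⊗₁ Free₁ Δ) ∘ (Ξ ∘ T₁ Δ))
        ≡⟨ trans (sym assoc) (∘-congʳ (sym (⊗₁-factor id≡id∘T₁id refl))) ⟩
      map (idH ⊗₁ δ X) ∘ (Ξ ∘ T₁ Δ) ∎

    cocomm : map σ ∘ (Ξ ∘ T₁ Δ) ≡ Ξ ∘ T₁ Δ
    cocomm = begin
      map σ ∘ (Ξ ∘ T₁ Δ)        ≡⟨ trans (pullˡ ξ⁻¹-symmetric) assoc ⟩
      Ξ ∘ (T₁ swap ∘ T₁ Δ)      ≡⟨ ∘-congˡ (trans (sym T-∘) (cong T₁ swap∘Δ)) ⟩
      Ξ ∘ T₁ Δ                  ∎

  retract-isCommComonoid :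
    ∀ {Y A} {δY : AlgHom Y (Y ⊗₀ Y)} {εY : AlgHom Y I} (r : AlgHom Y A) (s : AlgHom A Y) →
    IsCommComonoid Y δY εY → (r ∘H s) ≈H idH →
    ((s ⊗₁ s) ∘H (r ⊗₁ r) ∘H δY ∘H s) ≈H (δY ∘H s) →
    IsCommComonoid A ((r ⊗₁ r) ∘H δY ∘H s) (εY ∘H s)
  retract-isCommComonoid {Y} {A} {δY} {εY} r s Y-comonoid r∘s≈id s-preserves-δ = record
    { counitˡ = counitˡ ; counitʳ = counitʳ ; coassoc = coassoc ; cocomm = cocomm }
    where
    module Y = IsCommComonoid Y-comonoid
    d = (r ⊗₁ r) ∘H δY ∘H s

    ⊗₁-∘-d : ∀ {B B′} {f : AlgHom A B} {g : AlgHom A B′}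
                       (f′ : AlgHom Y B) (g′ : AlgHom Y B′) →
                       map f ≡ map f′ ∘ map s → map g ≡ map g′ ∘ map s →
                       map (f ⊗₁ g) ∘ map d ≡ map (f′ ⊗₁ g′) ∘ (map δY ∘ map s)
    ⊗₁-∘-d f′ g′ f≈ g≈ =
      trans (∘-congʳ (⊗₁-factor f≈ g≈)) (trans assoc (∘-congˡ s-preserves-δ))

    counitˡ : map λ⇒ ∘ (map ((εY ∘H s) ⊗₁ idH) ∘ map d) ≡ id
    counitˡ = begin
      map λ⇒ ∘ (map ((εY ∘H s) ⊗₁ idH) ∘ map d)
        ≡⟨ ∘-congˡ (⊗₁-∘-d εY r refl (sym r∘s≈id)) ⟩
      map λ⇒ ∘ (map (εY ⊗₁ r) ∘ (map δY ∘ map s))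
        ≡⟨ ∘-congˡ (trans (∘-congʳ (⊗₁-factor (sym identityˡ) (sym identityʳ))) assoc) ⟩
      map λ⇒ ∘ (map (idH ⊗₁ r) ∘ (map (εY ⊗₁ idH) ∘ (map δY ∘ map s)))
        ≡⟨ trans (pullˡ (sym λ-natural)) assoc ⟩
      map r ∘ (map λ⇒ ∘ (map (εY ⊗₁ idH) ∘ (map δY ∘ map s)))
        ≡⟨ ∘-congˡ (trans (sym assoc³) (trans (∘-congʳ Y.counitˡ) identityˡ)) ⟩
      map r ∘ map s
        ≡⟨ r∘s≈id ⟩
      id ∎

    counitʳ : map ρ⇒ ∘ (map (idH ⊗₁ (εY ∘H s)) ∘ map d) ≡ id
    counitʳ = begin
      map ρ⇒ ∘ (map (idH ⊗₁ (εY ∘H s)) ∘ map d)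
        ≡⟨ ∘-congˡ (⊗₁-∘-d r εY (sym r∘s≈id) refl) ⟩
      map ρ⇒ ∘ (map (r ⊗₁ εY) ∘ (map δY ∘ map s))
        ≡⟨ ∘-congˡ (trans (∘-congʳ (⊗₁-factor (sym identityʳ) (sym identityˡ))) assoc) ⟩
      map ρ⇒ ∘ (map (r ⊗₁ idH) ∘ (map (idH ⊗₁ εY) ∘ (map δY ∘ map s)))
        ≡⟨ trans (pullˡ (sym ρ-natural)) assoc ⟩
      map r ∘ (map ρ⇒ ∘ (map (idH ⊗₁ εY) ∘ (map δY ∘ map s)))
        ≡⟨ ∘-congˡ (trans (sym assoc³) (trans (∘-congʳ Y.counitʳ) identityˡ)) ⟩
      map r ∘ map s
        ≡⟨ r∘s≈id ⟩
      id ∎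

    coassoc : map α⇒ ∘ (map (d ⊗₁ idH) ∘ map d) ≡ map (idH ⊗₁ d) ∘ map d
    coassoc = begin
      map α⇒ ∘ (map (d ⊗₁ idH) ∘ map d)
        ≡⟨ ∘-congˡ (⊗₁-∘-d ((r ⊗₁ r) ∘H δY) r (sym assoc) (sym r∘s≈id)) ⟩
      map α⇒ ∘ (map (((r ⊗₁ r) ∘H δY) ⊗₁ r) ∘ (map δY ∘ map s))
        ≡⟨ ∘-congˡ (trans (∘-congʳ (⊗₁-factor refl (sym identityʳ))) assoc) ⟩
      map α⇒ ∘ (map ((r ⊗₁ r) ⊗₁ r) ∘ (map (δY ⊗₁ idH) ∘ (map δY ∘ map s)))
        ≡⟨ trans (pullˡ (sym α-natural)) assoc ⟩
      map (r ⊗₁ (r ⊗₁ r)) ∘ (map α⇒ ∘ (map (δY ⊗₁ idH) ∘ (map δY ∘ map s)))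
        ≡⟨ ∘-congˡ (trans (sym assoc³) (trans (∘-congʳ Y.coassoc) assoc)) ⟩
      map (r ⊗₁ (r ⊗₁ r)) ∘ (map (idH ⊗₁ δY) ∘ (map δY ∘ map s))
        ≡⟨ trans (sym assoc) (∘-congʳ (sym (⊗₁-factor (sym identityʳ) refl))) ⟩
      map (r ⊗₁ ((r ⊗₁ r) ∘H δY)) ∘ (map δY ∘ map s)
        ≡⟨ sym (⊗₁-∘-d r ((r ⊗₁ r) ∘H δY) (sym r∘s≈id) (sym assoc)) ⟩
      map (idH ⊗₁ d) ∘ map d ∎

    cocomm : map σ ∘ map d ≡ map d
    cocomm = begin
      map σ ∘ (map (r ⊗₁ r) ∘ (map δY ∘ map s))    ≡⟨ trans (pullˡ (sym σ-natural)) assoc ⟩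
      map (r ⊗₁ r) ∘ (map σ ∘ (map δY ∘ map s))    ≡⟨ ∘-congˡ (pullˡ Y.cocomm) ⟩
      map (r ⊗₁ r) ∘ (map δY ∘ map s)              ∎

  basisHom : (A : Algebra) → Basis A → AlgHom A (Free (Carrier A))
  basisHom A β = mkHom (Basis.b β) (Basis.b-str β)

  basisHom-preserves-δ : (A : Algebra) (β : Basis A) →
    let s = basisHom A β in
    ((s ⊗₁ s) ∘H (asHom A ⊗₁ asHom A) ∘H δ (Carrier A) ∘H s) ≈H (δ (Carrier A) ∘H s)
  basisHom-preserves-δ A β = begin
    map (s ⊗₁ s) ∘ (map (asHom A ⊗₁ asHom A) ∘ (map (δ X) ∘ b))
      ≡⟨ pullˡ (sym ⊗-∘) ⟩
    map ((s ∘H asHom A) ⊗₁ (s ∘H asHom A)) ∘ (map (δ X) ∘ b)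
      ≡⟨ trans (∘-congʳ (⊗₁-factor b-str b-str)) assoc ⟩
    map (μX ⊗₁ μX) ∘ (map (Free₁ b ⊗₁ Free₁ b) ∘ (map (δ X) ∘ b))
      ≡⟨ ∘-congˡ (trans (pullˡ δ-natural) assoc) ⟩
    map (μX ⊗₁ μX) ∘ (map (δ (T₀ X)) ∘ (T₁ b ∘ b))
      ≡⟨ ∘-congˡ (∘-congˡ (sym b-coassoc)) ⟩
    map (μX ⊗₁ μX) ∘ (map (δ (T₀ X)) ∘ (T₁ (η X) ∘ b))
      ≡⟨ ∘-congˡ (trans (sym assoc) (trans (∘-congʳ (sym δ-natural)) assoc)) ⟩
    map (μX ⊗₁ μX) ∘ (map (Free₁ (η X) ⊗₁ Free₁ (η X)) ∘ (map (δ X) ∘ b))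
      ≡⟨ pullˡ (trans (sym ⊗-∘) (⊗₁-identity μ-unitʳ μ-unitʳ)) ⟩
    id ∘ (map (δ X) ∘ b)
      ≡⟨ identityˡ ⟩
    map (δ X) ∘ b ∎
    where
    open Basis β
    X = Carrier A
    s = basisHom A β
    μX = asHom (Free X)

proposition6p1 : ∀ {o ℓ : Level} (C : Category o ℓ) (P : FiniteProducts C)
    (T : CommutativeMonad C P)
    (S : SymMonoidalAlg C P (CommutativeMonad.monad T))
    (Fm : StrongMonoidalFree C P (CommutativeMonad.monad T) S)
    (A : Alg.Algebra C (CommutativeMonad.monad T))
    (β : Alg.Basis C (CommutativeMonad.monad T) A) →
    Comonoid.Conclusion C P (CommutativeMonad.monad T) S Fm A β
proposition6p1 C P T S Fm A β =
  comm d , comm u , subst (λ d′ → IsCommComonoid A d′ u) reassociate restricted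
  where
  M = CommutativeMonad.monad T
  open Category C
  open FiniteProducts P
  open Alg C M
  open SymMonoidalAlg S
  open StrongMonoidalFree Fm
  open Comonoid C P M S Fm
  open MonoidalAlgLemmas C P M S
  open FreeComonoids C P M S Fm

  X = Carrier A
  r = asHom A
  s = basisHom A β

  d : AlgHom A (A ⊗₀ A)
  d = r ⊗₁ r ∘H ξ⁻¹ X X ∘H Free₁ Δ ∘H s

  u : AlgHom A I
  u = ε X ∘H s

  restricted : IsCommComonoid A (r ⊗₁ r ∘H δ X ∘H s) u
  restricted = retract-isCommComonoid r s (free-isCommComonoid X)
                 (Basis.str-b β) (basisHom-preserves-δ A β)

  reassociate : r ⊗₁ r ∘H δ X ∘H s ≡ d
  reassociate = AlgHom-≡ (cong (map (r ⊗₁ r) ∘_) assoc)
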